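{- There exist an alphabet $A$ and words $\mathbf a,\mathbf c\in A^\ast$ such that $\mathbf a:\mathbf a^r::_m\mathbf c:\mathbf c^r$ does not hold in $(A^\ast,\cdot,A^\ast)$, where $\mathbf w^r$ denotes the reverse of the word $\mathbf w$.
   Context: The reverse of $\mathbf w=w_1\ldots w_n$ is $w_n\ldots w_1$. $(A^\ast,\cdot,A^\ast)$ is the algebra of all words over $A$ (including the empty word) with concatenation and a constant symbol for every word. A justification is a pair of terms $s\to t$ with every variable of $t$ occurring in $s$; $\uparrow(\mathbf a\to\mathbf b)$ is the set of justifications with $\mathbf a=s(\mathbf o)$, $\mathbf b=t(\mathbf o)$ for some assignment $\mathbf o$ of words to the variables. $\uparrow^m(\mathbf a\to\mathbf b)$ keeps those whose terms contain only a single fixed variable $x$, occurring at most once on each side. $\uparrow^m(\mathbf a\to\mathbf b:\!\cdot\,\mathbf c\to\mathbf d):=\uparrow^m(\mathbf a\to\mathbf b)\cap\uparrow^m(\mathbf c\to\mathbf d)$; a monolinear justification is trivial if it lies in all such sets. $\mathbf a\to\mathbf b:\!\cdot_m\,\mathbf c\to\mathbf d$ holds iff either (a) $\uparrow^m(\mathbf a\to\mathbf b)\cup\uparrow^m(\mathbf c\to\mathbf d)$ consists only of trivial justifications, or (b) with $J_{\mathbf e}$ denoting $\uparrow^m(\mathbf a\to\mathbf b:\!\cdot\,\mathbf c\to\mathbf e)$ minus trivial justifications, $J_{\mathbf d}\neq\emptyset$ and $J_{\mathbf d}\subseteq J_{\mathbf d'}$ implies $J_{\mathbf d'}\subseteq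 J_{\mathbf d}$ for every word $\mathbf d'$. Then $\mathbf a:\mathbf b::_m\mathbf c:\mathbf d$ iff $\mathbf a\to\mathbf b:\!\cdot_m\,\mathbf c\to\mathbf d$, $\mathbf b\to\mathbf a:\!\cdot_m\,\mathbf d\to\mathbf c$, $\mathbf c\to\mathbf d:\!\cdot_m\,\mathbf a\to\mathbf b$, $\mathbf d\to\mathbf c:\!\cdot_m\,\mathbf b\to\mathbf a$ all hold. -}

module Defs where

open import Data.Nat using (ℕ; zero; suc; _+_; _≤_)
open import Data.List using (List; []; _++_; reverse)
open import Data.Product using (Σ; ∃; _×_; _,_)
open import Data.Sum using (_⊎_)
open import Relation.Nullary using (¬_)
open import Relation.Binary.PropositionalEquality using (_≡_)

module _ {A : Set} where

  -- Terms of the algebra (A* , · , A*) in the single fixed variable x: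
  -- the variable, a constant symbol for every word, and concatenation.
  data Term : Set where
    var   : Term
    const : List A → Term
    _·_   : Term → Term → Term

  occ : Term → ℕ
  occ var       = 1
  occ (const _) = 0
  occ (s · t)   = occ s + occ t

  eval : List A → Term → List A
  eval o var       = o
  eval o (const w) = w
  eval o (s · t)   = eval o s ++ eval o t

  -- monolinear justification s → t: x occurs at most once on each side,
  -- and every variable of t occurs in s (occ t ≤ occ s).
  record MJust : Set where
    constructor just
    field
      lhs    : Term
      rhs    : Term
      lhs≤1  : occ lhs ≤ 1
      rhs≤1  : occ rhs ≤ 1
      vars⊆  : occ rhs ≤ occ lhs
  open MJust public

  _∈↑_⇒_ : MJust → List A → List A → Set
  j ∈↑ a ⇒ b = ∃ λ (o : List A) → (eval o (lhs j) ≡ a) × (eval o (rhs j) ≡ b)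

  _∈↑_⇒_∶_⇒_ : MJust → List A → List A → List A → List A → Set
  j ∈↑ a ⇒ b ∶ c ⇒ d = (j ∈↑ a ⇒ b) × (j ∈↑ c ⇒ d)

  Trivial : MJust → Set
  Trivial j = ∀ a b c d → j ∈↑ a ⇒ b ∶ c ⇒ d

  J : List A → List A → List A → List A → MJust → Set
  J a b c e j = (j ∈↑ a ⇒ b ∶ c ⇒ e) × ¬ Trivial j

  ArrowRel : List A → List A → List A → List A → Set
  ArrowRel a b c d =
      (∀ j → (j ∈↑ a ⇒ b) ⊎ (j ∈↑ c ⇒ d) → Trivial j)
    ⊎ ( (∃ λ j → J a b c d j)
      × (∀ d' → (∀ j → J a b c d j → J a b c d' j)
              → (∀ j → J a b c d' j → J a b c d j)))

  Analogy : List A → List A → List A → List A → Set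
  Analogy a b c d =
    ArrowRel a b c d × ArrowRel b a d c × ArrowRel c d a b × ArrowRel d c b a

-- A monolinear justification that also justifies [] → [] can contain only empty
-- constants, so under every assignment o its sides evaluate to [] or to o. Hence it
-- relates a to b only if a or b is empty or a = b; for a = 01 and c = [] the
-- set ↑ᵐ(a → aʳ :· c → cʳ) is empty, and a → aʳ :·ₘ c → cʳ fails in both of its clauses:
-- the constant justification a → aʳ is not trivial, and J_{cʳ} is empty.
module Submission where

open import Defs
open import Data.Nat using (ℕ; zero; suc; _+_; _≤_; z≤n; s≤s)
open import Data.Fin using (Fin; zero; suc)
open import Data.List using (List; []; _∷_; _++_; concat; replicate; reverse)
open import Data.List.Properties using (++-identityʳ; ++-conicalˡ; ++-conicalʳ; concat-++)
open import Data.Product using (Σ; ∃; _,_; proj₁)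
open import Data.Sum using (_⊎_; inj₁; inj₂)
open import Relation.Nullary using (¬_)
open import Relation.Binary.PropositionalEquality using (_≡_; refl; sym; trans; cong; cong₂)
open Relation.Binary.PropositionalEquality.≡-Reasoning

module _ {A : Set} where

  power : ℕ → List A → List A
  power n o = concat (replicate n o)

  replicate-+ : ∀ m n (o : List A) → replicate (m + n) o ≡ replicate m o ++ replicate n o
  replicate-+ zero    n o = refl
  replicate-+ (suc m) n o = cong (o ∷_) (replicate-+ m n o)

  power-+ : ∀ m n (o : List A) → power (m + n) o ≡ power m o ++ power n o
  power-+ m n o = begin
    concat (replicate (m + n) o)             ≡⟨ cong concat (replicate-+ m n o) ⟩
    concat (replicate m o ++ replicate n o)  ≡⟨ sym (concat-++ (replicate m o) (replicate n o)) ⟩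
    power m o ++ power n o                   ∎

  eval-constant-free : ∀ (t : Term {A}) o′ o → eval o′ t ≡ [] → eval o t ≡ power (occ t) o
  eval-constant-free var       o′ o _ = sym (++-identityʳ o)
  eval-constant-free (const w) o′ o e = e
  eval-constant-free (s · t)   o′ o e = begin
    eval o s ++ eval o t                 ≡⟨ cong₂ _++_ (eval-constant-free s o′ o (++-conicalˡ _ _ e))
                                                       (eval-constant-free t o′ o (++-conicalʳ (eval o′ s) _ e)) ⟩
    power (occ s) o ++ power (occ t) o   ≡⟨ sym (power-+ (occ s) (occ t) o) ⟩
    power (occ s + occ t) o              ∎

  eval-monolinear-constant-free : ∀ (t : Term {A}) o′ o → occ t ≤ 1 → eval o′ t ≡ [] →
                                  eval o t ≡ [] ⊎ eval o t ≡ o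
  eval-monolinear-constant-free t o′ o occ≤1 e with occ t | eval-constant-free t o′ o e
  ... | zero     | p = inj₁ p
  ... | suc zero | p = inj₂ (trans p (++-identityʳ o))
  eval-monolinear-constant-free t o′ o (s≤s ()) e | suc (suc _) | _

  ∈↑[]⇒[]-collapse : ∀ (j : MJust {A}) {u v} → j ∈↑ [] ⇒ [] → j ∈↑ u ⇒ v →
                     u ≡ [] ⊎ v ≡ [] ⊎ u ≡ v
  ∈↑[]⇒[]-collapse (just l r l≤1 r≤1 r≤l) (o′ , el′ , er′) (o , refl , refl)
    with eval-monolinear-constant-free l o′ o l≤1 el′ | eval-monolinear-constant-free r o′ o r≤1 er′
  ... | inj₁ el | _      = inj₁ el
  ... | inj₂ _  | inj₁ er = inj₂ (inj₁ er)
  ... | inj₂ el | inj₂ er = inj₂ (inj₂ (trans el (sym er)))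

  -- In the first clause of :·ₘ the constant justification a → b must be trivial.
  arrowRel⇒justified : ∀ {a b c d : List A} → ArrowRel a b c d → ∃ λ j → j ∈↑ a ⇒ b ∶ c ⇒ d
  arrowRel⇒justified {a} {b} {c} {d} (inj₁ allTrivial) =
    j , allTrivial j (inj₁ ([] , refl , refl)) a b c d
    where
      j : MJust
      j = just (const a) (const b) z≤n z≤n z≤n
  arrowRel⇒justified (inj₂ ((j , j∈ , _) , _)) = j , j∈

¬arrowRel-01 : ¬ ArrowRel {Fin 2} (zero ∷ suc zero ∷ []) (suc zero ∷ zero ∷ []) [] []
¬arrowRel-01 rel with arrowRel⇒justified rel
... | j , j∈ab , j∈[] with ∈↑[]⇒[]-collapse j j∈[] j∈ab
... | inj₁ ()
... | inj₂ (inj₁ ())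
... | inj₂ (inj₂ ())

mainTheorem15 : Σ ℕ λ n → Σ (List (Fin (suc n))) λ a → Σ (List (Fin (suc n))) λ c →
                  ¬ Analogy a (reverse a) c (reverse c)
mainTheorem15 = 1 , zero ∷ suc zero ∷ [] , [] , λ analogy → ¬arrowRel-01 (proj₁ analogy)
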